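{- For all integers $n\ge 1$, $k\ge 0$ and $A$, $$M_k(n,A)=\sum_{j=0}^k\binom{k}{j}(A-1)^{k-j}M_j(n-1,A-1)+\sum_{j=0}^k\binom{k}{j}A^{k-j}M_j(n-1,A)+A\sum_{j=0}^k\binom{k}{j}(A-1)^{k-j}M_j(n-1,A)+(A+1)\sum_{j=0}^k\binom{k}{j}A^{k-j}M_j(n-1,A+1).$$
   Context: A marked set partition of $[n]$ is a set partition of $[n]=\{1,\dots,n\}$ with each block marked open or closed. For such $\lambda$ with blocks $\mathbf{B}_1,\mathbf{B}_2,\dots$, let $o(\lambda)$ be the number of open blocks, $\ell(\lambda)$ the number of blocks, and $\tilde d(\lambda)=\sum_{\mathbf{B}_j\text{ closed}}\max(\mathbf{B}_j)-\sum_{\mathbf{B}_j}\min(\mathbf{B}_j)+\ell(\lambda)+n(o(\lambda)-1)$. Define $M_k(n,A)=\sum\tilde d(\lambda)^k$, the sum over marked set partitions $\lambda$ of $[n]$ with $o(\lambda)=A$ (empty sums are $0$, so $M_k(n,A)=0$ for $A<0$). Convention: $0^0=1$. -}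

module Defs where

open import Data.Nat as ℕ using (ℕ; zero; suc; _⊔_)
open import Data.Nat.Combinatorics using (_C_)
open import Data.Integer as ℤ using (ℤ; +_; _-_; _*_; _^_)
open import Data.Integer.Properties using () renaming (_≟_ to _≟ℤ_)
open import Data.Fin as Fin using (Fin; toℕ)
open import Data.Fin.Properties using (all?) renaming (_≟_ to _≟F_)
open import Data.Vec as Vec using (Vec; lookup)
open import Data.Bool using (Bool; true; false; if_then_else_; _≟_)
open import Data.List as List using (List; []; _∷_; allFin; map; filter; foldr; cartesianProduct; upTo)
open import Data.Product using (_×_; _,_; proj₁; proj₂)
open import Relation.Binary.PropositionalEquality using (_≡_; _≢_)
open import Relation.Nullary using (¬_; Dec; yes; no; ¬?)
open import Relation.Nullary.Decidable using (_×-dec_; _→-dec_; ⌊_⌋)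

Σℤ : List ℤ → ℤ
Σℤ = foldr ℤ._+_ (+ 0)

vecsOver : {A : Set} → List A → (m : ℕ) → List (Vec A m)
vecsOver xs zero    = Vec.[] ∷ []
vecsOver xs (suc m) = List.concatMap (λ x → map (x Vec.∷_) (vecsOver xs m)) xs

-- The ground set [n] is represented by Fin n, element i : Fin n standing
-- for the integer toℕ i + 1.  A set partition is encoded (uniquely) by the
-- map  rep : [n] → [n]  sending every element to the minimum of its block;
-- such maps are exactly those with rep i ≤ i and rep (rep i) = rep i.
-- The blocks are indexed by their minima, i.e. by the i with rep i = i.
-- A marking assigns to every element a Bool; only the value at block
-- minima is meaningful (true = open, false = closed), and to make the
-- encoding unique we require the mark to be false at non-minima.

Carrier : ℕ → Set
Carrier n = Vec (Fin n) n × Vec Bool n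

IsMSP : (n : ℕ) → Carrier n → Set
IsMSP n (rep , mk) =
  (∀ i → toℕ (lookup rep i) ℕ.≤ toℕ i) ×
  (∀ i → lookup rep (lookup rep i) ≡ lookup rep i) ×
  (∀ i → lookup rep i ≢ i → lookup mk i ≡ false)

isMSP? : (n : ℕ) → (c : Carrier n) → Dec (IsMSP n c)
isMSP? n (rep , mk) =
  all? (λ i → toℕ (lookup rep i) ℕ.≤? toℕ i) ×-dec
  (all? (λ i → lookup rep (lookup rep i) ≟F lookup rep i) ×-dec
   all? (λ i → ¬? (lookup rep i ≟F i) →-dec (lookup mk i ≟ false)))

markedSetPartitions : (n : ℕ) → List (Carrier n)
markedSetPartitions n =
  filter (isMSP? n) (cartesianProduct (vecsOver (allFin n) n) (vecsOver (true ∷ false ∷ []) n))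

isBlock : {n : ℕ} → Carrier n → Fin n → Bool
isBlock (rep , mk) i = ⌊ lookup rep i ≟F i ⌋

isOpenBlock : {n : ℕ} → Carrier n → Fin n → Bool
isOpenBlock c i = if isBlock c i then lookup (proj₂ c) i else false

isClosedBlock : {n : ℕ} → Carrier n → Fin n → Bool
isClosedBlock c i = if isBlock c i then (if lookup (proj₂ c) i then false else true) else false

count : {n : ℕ} → (Fin n → Bool) → ℕ
count {n} p = List.length (filter (λ i → p i ≟ true) (allFin n))

blockMin : {n : ℕ} → Fin n → ℕ
blockMin i = suc (toℕ i)

blockMax : {n : ℕ} → Carrier n → Fin n → ℕ
blockMax {n} (rep , mk) i =
  foldr (λ j m → if ⌊ lookup rep j ≟F i ⌋ then suc (toℕ j) ⊔ m else m) 0 (allFin n)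

o : {n : ℕ} → Carrier n → ℕ
o c = count (isOpenBlock c)

ℓ : {n : ℕ} → Carrier n → ℕ
ℓ c = count (isBlock c)

dtilde : {n : ℕ} → Carrier n → ℤ
dtilde {n} c =
  Σℤ (map (λ i → if isClosedBlock c i then + blockMax c i else + 0) (allFin n))
  - Σℤ (map (λ i → if isBlock c i then + blockMin i else + 0) (allFin n))
  ℤ.+ + ℓ c
  ℤ.+ + n * (+ o c - + 1)

-- M_k(n, A) = Σ_{λ marked set partition of [n], o(λ) = A} d̃(λ)^k
-- (ℤ's _^_ has x ^ 0 = 1, so 0^0 = 1.)
M : (k n : ℕ) → (A : ℤ) → ℤ
M k n A = Σℤ (map (λ c → dtilde c ^ k)
                  (filter (λ c → + o c ≟ℤ A) (markedSetPartitions n)))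

binomSum : (k : ℕ) → (x : ℤ) → (m : ℕ) → (B : ℤ) → ℤ
binomSum k x m B =
  Σℤ (map (λ j → + (k C j) * (x ^ (k ℕ.∸ j)) * M j m B) (upTo (suc k)))

module Submission where

-- Every marked set partition of [m+1] arises exactly once from a marked set
-- partition λ′ of [m] by inserting m+1 with a label: either m+1 forms a new
-- singleton block, marked open or closed, or m+1 joins one of the o(λ′) open
-- blocks of λ′, which afterwards stays open or becomes closed.  The statistics
-- change by explicit amounts:
--   new block (open / closed):        d̃ ↦ d̃ + o(λ′),      o ↦ o(λ′) + 1 / o(λ′);
--   joined open block (open / closed): d̃ ↦ d̃ + o(λ′) - 1,  o ↦ o(λ′) / o(λ′) - 1.
-- Summing d̃^k over the labels and expanding (d̃ + x)^k binomially produces the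
-- four sums of the corollary, the o(λ′) choices of an open block becoming the
-- factors A and A + 1.

open import Defs
open import Data.Nat as ℕ using (ℕ; zero; suc; _≤_; _∸_; _⊔_; s≤s; z≤n)
import Data.Nat.Properties as ℕP
open import Data.Nat.Combinatorics using (_C_)
open import Data.Integer using (ℤ; +_; -_; _+_; _-_; _*_; _^_)
import Data.Integer.Properties as ℤP
open import Data.Integer.Properties using () renaming (_≟_ to _≟ℤ_)
open import Data.Integer.Tactic.RingSolver using (solve-∀)
open import Data.Bool using (Bool; true; false; if_then_else_) renaming (_≟_ to _≟B_)
open import Data.Empty using (⊥-elim)
open import Data.Product using (_×_; _,_; proj₁; proj₂; uncurry)
open import Data.Product.Properties using (,-injective)
open import Data.Maybe as Maybe using (Maybe; just; nothing; maybe′)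
import Data.Maybe.Properties as MaybeP
open import Data.Fin as Fin using (Fin; toℕ; inject₁; fromℕ) renaming (_≟_ to _≟F_)
open import Data.Fin.Properties
  using (suc-injective; inject₁-injective; toℕ-inject₁; toℕ-fromℕ; fromℕ≢inject₁; toℕ<n)
open import Data.Fin.Relation.Unary.Top using (View; view; ‵fromℕ; ‵inj₁)
open import Data.Vec as Vec using (Vec; lookup; tabulate)
open import Data.Vec.Properties using (∷-injective; lookup∘tabulate; tabulate-cong; tabulate∘lookup)
import Data.Vec.Functional as Vector
open import Data.List as List
  using (List; []; _∷_; _++_; map; filter; foldr; concatMap; allFin; cartesianProduct; upTo; applyUpTo)
import Data.List.Properties as ListP
open import Data.List.Membership.Propositional using (_∈_; find)
import Data.List.Membership.Propositional.Properties as ∈P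
open import Data.List.Membership.Propositional.Properties.WithK using (unique∧set⇒bag)
open import Data.List.Relation.Unary.Any using (here; there)
import Data.List.Relation.Unary.Any as Any
import Data.List.Relation.Unary.Any.Properties as AnyP
open import Data.List.Relation.Unary.All as All using (All; []; _∷_)
import Data.List.Relation.Unary.All.Properties as AllP
open import Data.List.Relation.Unary.AllPairs using ([]; _∷_)
open import Data.List.Relation.Unary.Unique.Propositional using (Unique)
import Data.List.Relation.Unary.Unique.Propositional.Properties as UniqueP
open import Data.List.Relation.Binary.BagAndSetEquality using (∼bag⇒↭; _∼[_]_; set)
open import Data.List.Relation.Binary.Permutation.Propositional using (_↭_; ↭⇒↭ₛ)
import Data.List.Relation.Binary.Permutation.Propositional.Properties as ↭P
open import Data.List.Relation.Binary.Permutation.Setoid.Properties using (foldr-commMonoid)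
open import Function using (_∘_; id; mk⇔)
open import Relation.Nullary using (Dec; yes; no; does; ¬_)
open import Relation.Nullary.Decidable using (⌊_⌋; dec-true; dec-false; isYes≗does)
open import Relation.Binary.PropositionalEquality
open import Algebra.Bundles using (Semiring)
open import Algebra.Properties.CommutativeSemigroup ℤP.+-commutativeSemigroup using (interchange)
import Algebra.Definitions.RawMonoid as RawMonoid
import Algebra.Properties.CommutativeSemiring.Binomial ℤP.+-*-commutativeSemiring as Binomial
import Algebra.Properties.Semiring.Exp ℤP.+-*-semiring as Exp

private variable
  m n : ℕ
  X Y Z : Set

sumOf : (X → ℤ) → List X → ℤ
sumOf f xs = Σℤ (map f xs)

sumOf-++ : (f : X → ℤ) (xs ys : List X) → sumOf f (xs ++ ys) ≡ sumOf f xs + sumOf f ys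
sumOf-++ f []       ys = sym (ℤP.+-identityˡ _)
sumOf-++ f (x ∷ xs) ys = trans (cong (_+_ (f x)) (sumOf-++ f xs ys)) (sym (ℤP.+-assoc (f x) _ _))

sumOf-concatMap : (f : Y → ℤ) (h : X → List Y) (xs : List X) →
  sumOf f (concatMap h xs) ≡ sumOf (λ x → sumOf f (h x)) xs
sumOf-concatMap f h []       = refl
sumOf-concatMap f h (x ∷ xs) =
  trans (sumOf-++ f (h x) (concatMap h xs)) (cong (_+_ (sumOf f (h x))) (sumOf-concatMap f h xs))

sumOf-map : (f : Y → ℤ) (g : X → Y) (xs : List X) → sumOf f (map g xs) ≡ sumOf (f ∘ g) xs
sumOf-map f g xs = cong Σℤ (sym (ListP.map-∘ xs))

sumOf-cong : {f g : X → ℤ} (xs : List X) → (∀ {x} → x ∈ xs → f x ≡ g x) → sumOf f xs ≡ sumOf g xs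
sumOf-cong []       e = refl
sumOf-cong (x ∷ xs) e = cong₂ _+_ (e (here refl)) (sumOf-cong xs (e ∘ there))

sumOf-+ : (f g : X → ℤ) (xs : List X) → sumOf (λ x → f x + g x) xs ≡ sumOf f xs + sumOf g xs
sumOf-+ f g []       = refl
sumOf-+ f g (x ∷ xs) =
  trans (cong (_+_ (f x + g x)) (sumOf-+ f g xs)) (interchange (f x) (g x) (sumOf f xs) (sumOf g xs))

sumOf-*ˡ : (c : ℤ) (f : X → ℤ) (xs : List X) → sumOf (λ x → c * f x) xs ≡ c * sumOf f xs
sumOf-*ˡ c f []       = sym (ℤP.*-zeroʳ c)
sumOf-*ˡ c f (x ∷ xs) = trans (cong (_+_ (c * f x)) (sumOf-*ˡ c f xs)) (sym (ℤP.*-distribˡ-+ c (f x) _))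

sumOf-const : (c : ℤ) (xs : List X) → sumOf (λ _ → c) xs ≡ + List.length xs * c
sumOf-const c []       = sym (ℤP.*-zeroˡ c)
sumOf-const c (x ∷ xs) = begin
  c + sumOf (λ _ → c) xs          ≡⟨ cong (_+_ c) (sumOf-const c xs) ⟩
  c + + List.length xs * c        ≡⟨ cong (_+ + List.length xs * c) (sym (ℤP.*-identityˡ c)) ⟩
  + 1 * c + + List.length xs * c  ≡⟨ sym (ℤP.*-distribʳ-+ c (+ 1) (+ List.length xs)) ⟩
  + List.length (x ∷ xs) * c      ∎
  where open ≡-Reasoning

sumOf-zero : (xs : List X) → sumOf (λ _ → + 0) xs ≡ + 0
sumOf-zero []       = refl
sumOf-zero (x ∷ xs) = trans (ℤP.+-identityˡ _) (sumOf-zero xs)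

sumOf-swap : (f : X → Y → ℤ) (xs : List X) (ys : List Y) →
  sumOf (λ x → sumOf (f x) ys) xs ≡ sumOf (λ y → sumOf (λ x → f x y) xs) ys
sumOf-swap f []       ys = sym (sumOf-zero ys)
sumOf-swap f (x ∷ xs) ys = trans (cong (_+_ (sumOf (f x) ys)) (sumOf-swap f xs ys))
  (sym (sumOf-+ (f x) (λ y → sumOf (λ x → f x y) xs) ys))

sumOf-filter : {P : X → Set} (P? : ∀ x → Dec (P x)) (f : X → ℤ) (xs : List X) →
  sumOf f (filter P? xs) ≡ sumOf (λ x → if does (P? x) then f x else + 0) xs
sumOf-filter P? f []       = refl
sumOf-filter P? f (x ∷ xs) with does (P? x)
... | true  = cong (_+_ (f x)) (sumOf-filter P? f xs)
... | false = trans (sumOf-filter P? f xs) (sym (ℤP.+-identityˡ _))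

sumOf-↭ : (f : X → ℤ) {xs ys : List X} → xs ↭ ys → sumOf f xs ≡ sumOf f ys
sumOf-↭ f p = foldr-commMonoid (setoid ℤ) ℤP.+-0-isCommutativeMonoid (↭⇒↭ₛ (↭P.map⁺ f p))

map-unique : (f : X → Y) (g : Y → X) (xs : List X) → (∀ {x} → x ∈ xs → g (f x) ≡ x) →
  Unique xs → Unique (map f xs)
map-unique f g []       inv []           = []
map-unique f g (x ∷ xs) inv (x∉ ∷ uniq) =
  AllP.map⁺ (All.zipWith (λ (x≢y , y↩) fx≡fy → x≢y (trans (sym (inv (here refl)))
                                                       (trans (cong g fx≡fy) y↩)))
                         (x∉ , All.tabulate (inv ∘ there)))
  ∷ map-unique f g xs (inv ∘ there) uniq

-- Reindexing a sum along a bijection: if g maps the duplicate-free list ys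
-- onto the duplicate-free list xs with inverse f, then map g ys is a
-- permutation of xs, so Σ_{x ∈ xs} F x = Σ_{y ∈ ys} F (g y).
sumOf-bijection : (g : Y → X) (f : X → Y) {xs : List X} {ys : List Y} → Unique xs → Unique ys →
  (∀ {y} → y ∈ ys → g y ∈ xs × f (g y) ≡ y) →
  (∀ {x} → x ∈ xs → f x ∈ ys × g (f x) ≡ x) →
  (F : X → ℤ) → sumOf F xs ≡ sumOf (F ∘ g) ys
sumOf-bijection g f {xs} {ys} uxs uys g-into f-into F = begin
  sumOf F xs          ≡⟨ sumOf-↭ F (∼bag⇒↭ (unique∧set⇒bag uxs image-unique image-is-xs)) ⟩
  sumOf F (map g ys)  ≡⟨ sumOf-map F g ys ⟩
  sumOf (F ∘ g) ys    ∎
  where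
  open ≡-Reasoning
  image-unique : Unique (map g ys)
  image-unique = map-unique g f ys (proj₂ ∘ g-into) uys
  image-is-xs : xs ∼[ set ] map g ys
  image-is-xs = mk⇔
    (λ x∈ → subst (_∈ map g ys) (proj₂ (f-into x∈)) (∈P.∈-map⁺ g (proj₁ (f-into x∈))))
    (λ x∈ → let (y , y∈ , x≡gy) = ∈P.∈-map⁻ g x∈ in subst (_∈ xs) (sym x≡gy) (proj₁ (g-into y∈)))

concatMap-unique : (pair : X → Y → Z) → (∀ {x x′ y y′} → pair x y ≡ pair x′ y′ → x ≡ x′ × y ≡ y′) →
  (h : X → List Y) (xs : List X) → Unique xs → (∀ x → Unique (h x)) →
  Unique (concatMap (λ x → map (pair x) (h x)) xs)
concatMap-unique pair pair-inj h []       _             _     = []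
concatMap-unique pair pair-inj h (x ∷ xs) (x∉xs ∷ uxs) uh =
  UniqueP.++⁺ (UniqueP.map⁺ (proj₂ ∘ pair-inj) (uh x)) (concatMap-unique pair pair-inj h xs uxs uh) disjoint
  where
  disjoint : ∀ {z} → ¬ (z ∈ map (pair x) (h x) × z ∈ concatMap (λ x → map (pair x) (h x)) xs)
  disjoint (z∈here , z∈rest) with ∈P.∈-map⁻ (pair x) z∈here
  ... | y , _ , refl with find (∈P.∈-concatMap⁻ (λ x → map (pair x) (h x)) {xs = xs} z∈rest)
  ...   | x′ , x′∈xs , z∈x′ = AllP.All¬⇒¬Any x∉xs (subst (_∈ xs) (sym x≡x′) x′∈xs)
    where
    x≡x′ : x ≡ x′
    x≡x′ = proj₁ (pair-inj (proj₂ (proj₂ (∈P.∈-map⁻ (pair x′) z∈x′))))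

vecsOver-unique : (xs : List X) → Unique xs → (n : ℕ) → Unique (vecsOver xs n)
vecsOver-unique xs uxs zero    = [] ∷ []
vecsOver-unique xs uxs (suc n) =
  concatMap-unique Vec._∷_ ∷-injective (λ _ → vecsOver xs n) xs uxs (λ _ → vecsOver-unique xs uxs n)

vecsOver-complete : (xs : List X) (n : ℕ) (v : Vec X n) → (∀ i → lookup v i ∈ xs) → v ∈ vecsOver xs n
vecsOver-complete xs zero    Vec.[]       _   = here refl
vecsOver-complete xs (suc n) (x Vec.∷ v) v⊆xs =
  ∈P.∈-concatMap⁺ (λ x → map (x Vec.∷_) (vecsOver xs n))
    (Any.map (λ { refl → ∈P.∈-map⁺ (x Vec.∷_) (vecsOver-complete xs n v (v⊆xs ∘ Fin.suc)) }) (v⊆xs Fin.zero))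

bools : List Bool
bools = true ∷ false ∷ []

∈-bools : (b : Bool) → b ∈ bools
∈-bools true  = here refl
∈-bools false = there (here refl)

bools-unique : Unique bools
bools-unique = ((λ ()) ∷ []) ∷ [] ∷ []

markedSetPartitions-unique : (n : ℕ) → Unique (markedSetPartitions n)
markedSetPartitions-unique n = UniqueP.filter⁺ (isMSP? n)
  (UniqueP.cartesianProduct⁺ (vecsOver-unique (allFin n) (UniqueP.allFin⁺ n) n) (vecsOver-unique bools bools-unique n))

markedSetPartitions-sound : (n : ℕ) {c : Carrier n} → c ∈ markedSetPartitions n → IsMSP n c
markedSetPartitions-sound n c∈ =
  proj₂ (∈P.∈-filter⁻ (isMSP? n) {xs = cartesianProduct (vecsOver (allFin n) n) (vecsOver bools n)} c∈)

markedSetPartitions-complete : (n : ℕ) {c : Carrier n} → IsMSP n c → c ∈ markedSetPartitions n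
markedSetPartitions-complete n {rep , mk} isMSP = ∈P.∈-filter⁺ (isMSP? n)
  (∈P.∈-cartesianProduct⁺ (vecsOver-complete (allFin n) n rep (λ _ → ∈P.∈-allFin _))
                          (vecsOver-complete bools n mk (∈-bools ∘ lookup mk)))
  isMSP

unlast : Fin (suc m) → Maybe (Fin m)
unlast {zero}  Fin.zero    = nothing
unlast {suc m} Fin.zero    = just Fin.zero
unlast {suc m} (Fin.suc j) = Maybe.map Fin.suc (unlast j)

unlast-inject₁ : (i : Fin m) → unlast (inject₁ i) ≡ just i
unlast-inject₁ {suc m} Fin.zero    = refl
unlast-inject₁ {suc m} (Fin.suc i) = cong (Maybe.map Fin.suc) (unlast-inject₁ i)

unlast-fromℕ : (m : ℕ) → unlast (fromℕ m) ≡ nothing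
unlast-fromℕ zero    = refl
unlast-fromℕ (suc m) = cong (Maybe.map Fin.suc) (unlast-fromℕ m)

unlast≡nothing : (j : Fin (suc m)) → unlast j ≡ nothing → j ≡ fromℕ m
unlast≡nothing {zero}  Fin.zero    _ = refl
unlast≡nothing {suc m} (Fin.suc j) e with unlast j in eq
... | nothing = cong Fin.suc (unlast≡nothing j eq)

unlast≡just : (j : Fin (suc m)) {i : Fin m} → unlast j ≡ just i → j ≡ inject₁ i
unlast≡just {suc m} Fin.zero    refl = refl
unlast≡just {suc m} (Fin.suc j) e with unlast j in eq
unlast≡just {suc m} (Fin.suc j) refl | just _ = cong Fin.suc (unlast≡just j eq)

last-or-old : {P : Fin (suc m) → Set} → P (fromℕ m) → (∀ i → P (inject₁ i)) → ∀ j → P j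
last-or-old {P = P} p-last p-old j = go (view j)
  where
  go : ∀ {j} → View j → P j
  go ‵fromℕ            = p-last
  go (‵inj₁ {i = i} _) = p-old i

vec-ext : {n : ℕ} (u v : Vec X n) → (∀ i → lookup u i ≡ lookup v i) → u ≡ v
vec-ext u v u≗v = trans (sym (tabulate∘lookup u)) (trans (tabulate-cong u≗v) (tabulate∘lookup v))

vec-ext-snoc : (u v : Vec X (suc m)) → (∀ i → lookup u (inject₁ i) ≡ lookup v (inject₁ i)) →
  lookup u (fromℕ m) ≡ lookup v (fromℕ m) → u ≡ v
vec-ext-snoc u v old≡ last≡ = vec-ext u v (last-or-old last≡ old≡)

snoc : (Fin m → X) → X → Fin (suc m) → X
snoc f a j = maybe′ f a (unlast j)

snoc-old : (f : Fin m → X) (a : X) (i : Fin m) → snoc f a (inject₁ i) ≡ f i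
snoc-old f a i = cong (maybe′ f a) (unlast-inject₁ i)

snoc-last : (f : Fin m → X) (a : X) → snoc f a (fromℕ m) ≡ a
snoc-last {m} f a = cong (maybe′ f a) (unlast-fromℕ m)

-- A label
-- (t , b) says where it goes: t = nothing, a new singleton block marked b;
-- t = just i₀, into the block with minimum i₀, which afterwards is marked b.
Label : ℕ → Set
Label m = Maybe (Fin m) × Bool

markAfter : Vec Bool m → Maybe (Fin m) → Bool → Fin m → Bool
markAfter mk nothing   b i = lookup mk i
markAfter mk (just i₀) b i = if does (i ≟F i₀) then b else lookup mk i

markAfter-untouched : (mk : Vec Bool m) (t : Maybe (Fin m)) (b : Bool) (i : Fin m) → t ≢ just i →
  markAfter mk t b i ≡ lookup mk i
markAfter-untouched mk nothing   b i _ = refl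
markAfter-untouched mk (just i₀) b i t≢i with i ≟F i₀
... | yes refl = ⊥-elim (t≢i refl)
... | no _     = refl

markAfter-target : (mk : Vec Bool m) (i₀ : Fin m) (b : Bool) → markAfter mk (just i₀) b i₀ ≡ b
markAfter-target mk i₀ b with i₀ ≟F i₀
... | yes _  = refl
... | no i≢i = ⊥-elim (i≢i refl)

markOfNew : Maybe (Fin m) → Bool → Bool
markOfNew nothing  b = b
markOfNew (just _) _ = false

targetRep : Maybe (Fin m) → Fin (suc m)
targetRep {m} = maybe′ inject₁ (fromℕ m)

newRep : Vec (Fin m) m → Maybe (Fin m) → Fin (suc m) → Fin (suc m)
newRep rep t = snoc (inject₁ ∘ lookup rep) (targetRep t)

newMark : Vec Bool m → Maybe (Fin m) → Bool → Fin (suc m) → Bool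
newMark mk t b = snoc (markAfter mk t b) (markOfNew t b)

insert : Carrier m → Label m → Carrier (suc m)
insert (rep , mk) (t , b) = tabulate (newRep rep t) , tabulate (newMark mk t b)

module _ (rep : Vec (Fin m) m) (mk : Vec Bool m) (t : Maybe (Fin m)) (b : Bool) where

  insert-rep-old : ∀ i → lookup (proj₁ (insert (rep , mk) (t , b))) (inject₁ i) ≡ inject₁ (lookup rep i)
  insert-rep-old i = trans (lookup∘tabulate (newRep rep t) (inject₁ i)) (snoc-old (inject₁ ∘ lookup rep) (targetRep t) i)

  insert-rep-last : lookup (proj₁ (insert (rep , mk) (t , b))) (fromℕ m) ≡ targetRep t
  insert-rep-last = trans (lookup∘tabulate (newRep rep t) (fromℕ m)) (snoc-last (inject₁ ∘ lookup rep) (targetRep t))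

  insert-mark-old : ∀ i → lookup (proj₂ (insert (rep , mk) (t , b))) (inject₁ i) ≡ markAfter mk t b i
  insert-mark-old i = trans (lookup∘tabulate (newMark mk t b) (inject₁ i)) (snoc-old (markAfter mk t b) (markOfNew t b) i)

  insert-mark-last : lookup (proj₂ (insert (rep , mk) (t , b))) (fromℕ m) ≡ markOfNew t b
  insert-mark-last = trans (lookup∘tabulate (newMark mk t b) (fromℕ m)) (snoc-last (markAfter mk t b) (markOfNew t b))

-- Deleting the last element.  restrict forgets m+1 (reopening the block it
-- belonged to, which must have been open for the label to be admissible) and
-- labelOf reads off the label of m+1.
lowerOr : Fin (suc m) → Fin m → Fin m
lowerOr j d = maybe′ id d (unlast j)

reopenAt : Maybe (Fin m) → (Fin m → Bool) → Fin m → Bool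
reopenAt nothing   f i = f i
reopenAt (just i₀) f i = if does (i ≟F i₀) then true else f i

restrict : Carrier (suc m) → Carrier m
restrict {m} (rep , mk) =
  tabulate (λ i → lowerOr (lookup rep (inject₁ i)) i) ,
  tabulate (reopenAt (unlast (lookup rep (fromℕ m))) (lookup mk ∘ inject₁))

labelFrom : Vec Bool (suc m) → Maybe (Fin m) → Label m
labelFrom {m} mk nothing   = nothing , lookup mk (fromℕ m)
labelFrom     mk (just i₀) = just i₀ , lookup mk (inject₁ i₀)

labelOf : Carrier (suc m) → Label m
labelOf {m} (rep , mk) = labelFrom mk (unlast (lookup rep (fromℕ m)))

openBlocks : Carrier m → List (Fin m)
openBlocks {m} c = filter (λ i → isOpenBlock c i ≟B true) (allFin m)

labels : Carrier m → List (Label m)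
labels c = concatMap (λ t → map (t ,_) bools) (nothing ∷ map just (openBlocks c))

data Target (c : Carrier m) : Maybe (Fin m) → Set where
  newBlock  : Target c nothing
  joinBlock : ∀ {i} → isOpenBlock c i ≡ true → Target c (just i)

isOpenBlock-intro : (rep : Vec (Fin m) m) (mk : Vec Bool m) (i : Fin m) →
  lookup rep i ≡ i → lookup mk i ≡ true → isOpenBlock (rep , mk) i ≡ true
isOpenBlock-intro rep mk i isMin isOpen with lookup rep i ≟F i
... | yes _     = isOpen
... | no notMin = ⊥-elim (notMin isMin)

isOpenBlock-elim : (rep : Vec (Fin m) m) (mk : Vec Bool m) (i : Fin m) →
  isOpenBlock (rep , mk) i ≡ true → lookup rep i ≡ i × lookup mk i ≡ true
isOpenBlock-elim rep mk i isOpen with lookup rep i ≟F i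
isOpenBlock-elim rep mk i isOpen | yes isMin = isMin , isOpen
isOpenBlock-elim rep mk i ()     | no _

∈-concatMap : (f : X → List Y) (xs : List X) {x : X} {y : Y} → x ∈ xs → y ∈ f x → y ∈ concatMap f xs
∈-concatMap f xs x∈ y∈ = ∈P.∈-concatMap⁺ f {xs = xs} (Any.map (λ { refl → y∈ }) x∈)

target∈labels : (c : Carrier m) {t : Maybe (Fin m)} → Target c t → (b : Bool) → (t , b) ∈ labels c
target∈labels {m} c newBlock b =
  ∈-concatMap (λ t → map (t ,_) bools) (nothing ∷ map just (openBlocks c))
    (here refl) (∈P.∈-map⁺ (nothing ,_) (∈-bools b))
target∈labels {m} c (joinBlock {i} isOpen) b =
  ∈-concatMap (λ t → map (t ,_) bools) (nothing ∷ map just (openBlocks c))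
    (there (∈P.∈-map⁺ just
      (∈P.∈-filter⁺ (λ i → isOpenBlock c i ≟B true) {xs = allFin m} (∈P.∈-allFin i) isOpen)))
    (∈P.∈-map⁺ (just i ,_) (∈-bools b))

labels-target : (c : Carrier m) {t : Maybe (Fin m)} {b : Bool} → (t , b) ∈ labels c → Target c t
labels-target {m} c t,b∈ with ∈P.∈-concatMap⁻ (λ t → map (t ,_) bools) {xs = nothing ∷ map just (openBlocks c)} t,b∈
... | here  t,b∈new with ∈P.∈-map⁻ (nothing ,_) t,b∈new
...   | _ , _ , refl = newBlock
labels-target {m} c t,b∈ | there t,b∈join with find (AnyP.map⁻ t,b∈join)
... | i , i∈ , t,b∈i with ∈P.∈-map⁻ (just i ,_) t,b∈i
...   | _ , _ , refl = joinBlock (proj₂ (∈P.∈-filter⁻ (λ i → isOpenBlock c i ≟B true) {xs = allFin m} i∈))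

labelFrom-target : (mk : Vec Bool (suc m)) (t : Maybe (Fin m)) → proj₁ (labelFrom mk t) ≡ t
labelFrom-target mk nothing  = refl
labelFrom-target mk (just _) = refl

module Restriction {m : ℕ} (rep : Vec (Fin (suc m)) (suc m)) (mk : Vec Bool (suc m))
                   (isMSP : IsMSP (suc m) (rep , mk)) where

  rep′ : Vec (Fin m) m
  rep′ = proj₁ (restrict (rep , mk))

  mk′ : Vec Bool m
  mk′ = proj₂ (restrict (rep , mk))

  target : Maybe (Fin m)
  target = unlast (lookup rep (fromℕ m))

  oldMarks : Fin m → Bool
  oldMarks = lookup mk ∘ inject₁

  restrict-rep : ∀ i → lookup rep′ i ≡ lowerOr (lookup rep (inject₁ i)) i
  restrict-rep i = lookup∘tabulate (λ i → lowerOr (lookup rep (inject₁ i)) i) i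

  restrict-mark : ∀ i → lookup mk′ i ≡ reopenAt target oldMarks i
  restrict-mark i = lookup∘tabulate (reopenAt target oldMarks) i

  -- Old elements keep their representative, which is old as well (rep i ≤ i < m).
  rep-old : ∀ i → lookup rep (inject₁ i) ≡ inject₁ (lookup rep′ i)
  rep-old i with unlast (lookup rep (inject₁ i)) in eq
  ... | nothing = ⊥-elim (ℕP.<-irrefl refl (ℕP.≤-<-trans m≤i (toℕ<n i)))
    where
    m≤i : m ℕ.≤ toℕ i
    m≤i = subst₂ ℕ._≤_ (trans (cong toℕ (unlast≡nothing _ eq)) (toℕ-fromℕ m)) (toℕ-inject₁ i)
                 (proj₁ isMSP (inject₁ i))
  ... | just _ = trans (unlast≡just _ eq) (cong inject₁ (sym (trans (restrict-rep i) (cong (maybe′ id i) eq))))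

  target-is-min : ∀ {i₀} → target ≡ just i₀ → lookup rep′ i₀ ≡ i₀
  target-is-min {i₀} eq = inject₁-injective (begin
    inject₁ (lookup rep′ i₀)          ≡⟨ sym (rep-old i₀) ⟩
    lookup rep (inject₁ i₀)           ≡⟨ cong (lookup rep) (sym last↦i₀) ⟩
    lookup rep (lookup rep (fromℕ m)) ≡⟨ proj₁ (proj₂ isMSP) (fromℕ m) ⟩
    lookup rep (fromℕ m)              ≡⟨ last↦i₀ ⟩
    inject₁ i₀                        ∎)
    where
    open ≡-Reasoning
    last↦i₀ : lookup rep (fromℕ m) ≡ inject₁ i₀
    last↦i₀ = unlast≡just _ eq

  reopenAt-other : ∀ {i i₀} (f : Fin m → Bool) → i ≢ i₀ → reopenAt (just i₀) f i ≡ f i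
  reopenAt-other {i} {i₀} f i≢i₀ with i ≟F i₀
  ... | yes i≡i₀ = ⊥-elim (i≢i₀ i≡i₀)
  ... | no _     = refl

  restrict-isMSP : IsMSP m (restrict (rep , mk))
  restrict-isMSP = below , idempotent , closedOffMin
    where
    below : ∀ i → toℕ (lookup rep′ i) ℕ.≤ toℕ i
    below i = subst₂ ℕ._≤_ (trans (cong toℕ (rep-old i)) (toℕ-inject₁ _)) (toℕ-inject₁ i) (proj₁ isMSP (inject₁ i))
    idempotent : ∀ i → lookup rep′ (lookup rep′ i) ≡ lookup rep′ i
    idempotent i = inject₁-injective (begin
      inject₁ (lookup rep′ (lookup rep′ i)) ≡⟨ sym (rep-old _) ⟩
      lookup rep (inject₁ (lookup rep′ i))  ≡⟨ cong (lookup rep) (sym (rep-old i)) ⟩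
      lookup rep (lookup rep (inject₁ i))   ≡⟨ proj₁ (proj₂ isMSP) (inject₁ i) ⟩
      lookup rep (inject₁ i)                ≡⟨ rep-old i ⟩
      inject₁ (lookup rep′ i)               ∎)
      where open ≡-Reasoning
    closedOffMin : ∀ i → lookup rep′ i ≢ i → lookup mk′ i ≡ false
    closedOffMin i notMin = trans (restrict-mark i) (reopened target refl)
      where
      oldClosed : oldMarks i ≡ false
      oldClosed = proj₂ (proj₂ isMSP) (inject₁ i) (λ e → notMin (inject₁-injective (trans (sym (rep-old i)) e)))
      reopened : ∀ t → target ≡ t → reopenAt t oldMarks i ≡ false
      reopened nothing   _  = oldClosed
      reopened (just i₀) eq with i ≟F i₀
      ... | yes refl = ⊥-elim (notMin (target-is-min eq))
      ... | no _     = oldClosed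

  -- The decoded target is admissible: that block is reopened by the restriction.
  target-of-restrict : Target (restrict (rep , mk)) target
  target-of-restrict = fromEq target refl
    where
    fromEq : ∀ t → target ≡ t → Target (restrict (rep , mk)) t
    fromEq nothing   _  = newBlock
    fromEq (just i₀) eq = joinBlock (isOpenBlock-intro rep′ mk′ i₀ (target-is-min eq) (begin
      lookup mk′ i₀                     ≡⟨ restrict-mark i₀ ⟩
      reopenAt target oldMarks i₀       ≡⟨ cong (λ t → reopenAt t oldMarks i₀) eq ⟩
      reopenAt (just i₀) oldMarks i₀    ≡⟨ reopenAt-self ⟩
      true                              ∎))
      where
      open ≡-Reasoning
      reopenAt-self : reopenAt (just i₀) oldMarks i₀ ≡ true
      reopenAt-self with i₀ ≟F i₀
      ... | yes _  = refl
      ... | no i≢i = ⊥-elim (i≢i refl)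

  labelOf∈labels : labelOf (rep , mk) ∈ labels (restrict (rep , mk))
  labelOf∈labels = subst (λ t → (t , proj₂ (labelOf (rep , mk))) ∈ labels (restrict (rep , mk)))
    (sym (labelFrom-target mk target)) (target∈labels _ target-of-restrict _)

  insert-restrict : insert (restrict (rep , mk)) (labelOf (rep , mk)) ≡ (rep , mk)
  insert-restrict = reassemble target refl
    where
    c′ : Carrier m
    c′ = restrict (rep , mk)
    reassemble : ∀ t → target ≡ t → insert c′ (labelFrom mk t) ≡ (rep , mk)
    reassemble nothing eq = cong₂ _,_
      (vec-ext-snoc _ _ (λ i → trans (insert-rep-old rep′ mk′ nothing b i) (sym (rep-old i)))
                        (trans (insert-rep-last rep′ mk′ nothing b) (sym (unlast≡nothing _ eq))))
      (vec-ext-snoc _ _ (λ i → trans (insert-mark-old rep′ mk′ nothing b i)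
                                     (trans (restrict-mark i) (cong (λ t → reopenAt t oldMarks i) eq)))
                        (insert-mark-last rep′ mk′ nothing b))
      where
      b : Bool
      b = lookup mk (fromℕ m)
    reassemble (just i₀) eq = cong₂ _,_
      (vec-ext-snoc _ _ (λ i → trans (insert-rep-old rep′ mk′ (just i₀) b i) (sym (rep-old i)))
                        (trans (insert-rep-last rep′ mk′ (just i₀) b) (sym last↦i₀)))
      (vec-ext-snoc _ _ (λ i → trans (insert-mark-old rep′ mk′ (just i₀) b i) (oldMark i))
                        (trans (insert-mark-last rep′ mk′ (just i₀) b)
                               (sym (proj₂ (proj₂ isMSP) (fromℕ m)
                                           (λ e → fromℕ≢inject₁ (trans (sym e) last↦i₀))))))
      where
      b : Bool
      b = lookup mk (inject₁ i₀)
      last↦i₀ : lookup rep (fromℕ m) ≡ inject₁ i₀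
      last↦i₀ = unlast≡just _ eq
      oldMark : ∀ i → markAfter mk′ (just i₀) b i ≡ lookup mk (inject₁ i)
      oldMark i with i ≟F i₀
      ... | yes refl = refl
      ... | no i≢i₀  = trans (restrict-mark i)
                             (trans (cong (λ t → reopenAt t oldMarks i) eq) (reopenAt-other oldMarks i≢i₀))

unlast-targetRep : (t : Maybe (Fin m)) → unlast (targetRep t) ≡ t
unlast-targetRep {m} nothing  = unlast-fromℕ m
unlast-targetRep     (just i) = unlast-inject₁ i

module Insertion {m : ℕ} (rep′ : Vec (Fin m) m) (mk′ : Vec Bool m) (isMSP : IsMSP m (rep′ , mk′))
                 {t : Maybe (Fin m)} (target : Target (rep′ , mk′) t) (b : Bool) where

  c : Carrier (suc m)
  c = insert (rep′ , mk′) (t , b)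

  rep : Vec (Fin (suc m)) (suc m)
  rep = proj₁ c

  mk : Vec Bool (suc m)
  mk = proj₂ c

  unlast-insert : unlast (lookup rep (fromℕ m)) ≡ t
  unlast-insert = trans (cong unlast (insert-rep-last rep′ mk′ t b)) (unlast-targetRep t)

  restrict-insert : restrict c ≡ (rep′ , mk′)
  restrict-insert = cong₂ _,_ (vec-ext _ _ repAgrees) (vec-ext _ _ markAgrees)
    where
    repAgrees : ∀ i → lookup (proj₁ (restrict c)) i ≡ lookup rep′ i
    repAgrees i = trans (lookup∘tabulate (λ i → lowerOr (lookup rep (inject₁ i)) i) i)
      (trans (cong (λ j → lowerOr j i) (insert-rep-old rep′ mk′ t b i)) (cong (maybe′ id i) (unlast-inject₁ _)))
    reopened : ∀ {t} → Target (rep′ , mk′) t → ∀ i → reopenAt t (markAfter mk′ t b) i ≡ lookup mk′ i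
    reopened newBlock i = refl
    reopened (joinBlock {i₀} isOpen) i with i ≟F i₀
    ... | yes refl = sym (proj₂ (isOpenBlock-elim rep′ mk′ i₀ isOpen))
    ... | no _     = refl
    reopenAt-cong : ∀ t (f g : Fin m → Bool) i → f i ≡ g i → reopenAt t f i ≡ reopenAt t g i
    reopenAt-cong nothing   f g i eq = eq
    reopenAt-cong (just i₀) f g i eq with i ≟F i₀
    ... | yes _ = refl
    ... | no _  = eq
    markAgrees : ∀ i → lookup (proj₂ (restrict c)) i ≡ lookup mk′ i
    markAgrees i = trans (lookup∘tabulate (reopenAt (unlast (lookup rep (fromℕ m))) (lookup mk ∘ inject₁)) i)
      (trans (cong (λ s → reopenAt s (lookup mk ∘ inject₁) i) unlast-insert)
      (trans (reopenAt-cong t _ (markAfter mk′ t b) i (insert-mark-old rep′ mk′ t b i)) (reopened target i)))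

  labelOf-insert : labelOf c ≡ (t , b)
  labelOf-insert = trans (cong (labelFrom mk) unlast-insert) (labelOfTarget target)
    where
    labelOfTarget : ∀ {t} → Target (rep′ , mk′) t → labelFrom (proj₂ (insert (rep′ , mk′) (t , b))) t ≡ (t , b)
    labelOfTarget newBlock = cong (nothing ,_) (insert-mark-last rep′ mk′ nothing b)
    labelOfTarget (joinBlock {i₀} _) =
      cong (just i₀ ,_) (trans (insert-mark-old rep′ mk′ (just i₀) b i₀) (markAfter-target mk′ i₀ b))

  insert-below : ∀ j → toℕ (lookup rep j) ℕ.≤ toℕ j
  insert-below = last-or-old belowLast belowOld
    where
    belowOld : ∀ i → toℕ (lookup rep (inject₁ i)) ℕ.≤ toℕ (inject₁ i)
    belowOld i = subst₂ ℕ._≤_ (sym (trans (cong toℕ (insert-rep-old rep′ mk′ t b i)) (toℕ-inject₁ _)))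
                              (sym (toℕ-inject₁ i)) (proj₁ isMSP i)
    targetRep≤m : ∀ t → toℕ (targetRep {m} t) ℕ.≤ m
    targetRep≤m nothing  = ℕP.≤-reflexive (toℕ-fromℕ m)
    targetRep≤m (just i) = ℕP.<⇒≤ (subst (ℕ._< m) (sym (toℕ-inject₁ i)) (toℕ<n i))
    belowLast : toℕ (lookup rep (fromℕ m)) ℕ.≤ toℕ (fromℕ m)
    belowLast = subst₂ ℕ._≤_ (cong toℕ (sym (insert-rep-last rep′ mk′ t b))) (sym (toℕ-fromℕ m)) (targetRep≤m t)

  insert-idempotent : ∀ j → lookup rep (lookup rep j) ≡ lookup rep j
  insert-idempotent = last-or-old (idempotentLast target) idempotentOld
    where
    open ≡-Reasoning
    repOld : ∀ i → lookup rep (inject₁ i) ≡ inject₁ (lookup rep′ i)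
    repOld = insert-rep-old rep′ mk′ t b
    idempotentOld : ∀ i → lookup rep (lookup rep (inject₁ i)) ≡ lookup rep (inject₁ i)
    idempotentOld i = begin
      lookup rep (lookup rep (inject₁ i))     ≡⟨ cong (lookup rep) (repOld i) ⟩
      lookup rep (inject₁ (lookup rep′ i))    ≡⟨ repOld _ ⟩
      inject₁ (lookup rep′ (lookup rep′ i))   ≡⟨ cong inject₁ (proj₁ (proj₂ isMSP) i) ⟩
      inject₁ (lookup rep′ i)                 ≡⟨ sym (repOld i) ⟩
      lookup rep (inject₁ i)                  ∎
    idempotentLast : ∀ {t} → Target (rep′ , mk′) t → let r = proj₁ (insert (rep′ , mk′) (t , b)) in
      lookup r (lookup r (fromℕ m)) ≡ lookup r (fromℕ m)
    idempotentLast newBlock = cong (lookup (proj₁ (insert (rep′ , mk′) (nothing , b)))) (insert-rep-last rep′ mk′ nothing b)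
    idempotentLast (joinBlock {i₀} isOpen) = begin
      lookup r (lookup r (fromℕ m)) ≡⟨ cong (lookup r) (insert-rep-last rep′ mk′ (just i₀) b) ⟩
      lookup r (inject₁ i₀)         ≡⟨ insert-rep-old rep′ mk′ (just i₀) b i₀ ⟩
      inject₁ (lookup rep′ i₀)      ≡⟨ cong inject₁ (proj₁ (isOpenBlock-elim rep′ mk′ i₀ isOpen)) ⟩
      inject₁ i₀                    ≡⟨ sym (insert-rep-last rep′ mk′ (just i₀) b) ⟩
      lookup r (fromℕ m)            ∎
      where
      r : Vec (Fin (suc m)) (suc m)
      r = proj₁ (insert (rep′ , mk′) (just i₀ , b))

  insert-closedOffMin : ∀ j → lookup rep j ≢ j → lookup mk j ≡ false
  insert-closedOffMin = last-or-old (closedLast target) closedOld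
    where
    closedLast : ∀ {t} → Target (rep′ , mk′) t → let c = insert (rep′ , mk′) (t , b) in
      lookup (proj₁ c) (fromℕ m) ≢ fromℕ m → lookup (proj₂ c) (fromℕ m) ≡ false
    closedLast newBlock notMin = ⊥-elim (notMin (insert-rep-last rep′ mk′ nothing b))
    closedLast (joinBlock {i₀} _) _ = insert-mark-last rep′ mk′ (just i₀) b
    markAfter-closed : ∀ {t} → Target (rep′ , mk′) t → ∀ i → lookup rep′ i ≢ i → markAfter mk′ t b i ≡ false
    markAfter-closed newBlock i notMin = proj₂ (proj₂ isMSP) i notMin
    markAfter-closed (joinBlock {i₀} isOpen) i notMin with i ≟F i₀
    ... | yes refl = ⊥-elim (notMin (proj₁ (isOpenBlock-elim rep′ mk′ i₀ isOpen)))
    ... | no _     = proj₂ (proj₂ isMSP) i notMin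
    closedOld : ∀ i → lookup rep (inject₁ i) ≢ inject₁ i → lookup mk (inject₁ i) ≡ false
    closedOld i notMin = trans (insert-mark-old rep′ mk′ t b i)
      (markAfter-closed target i (λ isMin → notMin (trans (insert-rep-old rep′ mk′ t b i) (cong inject₁ isMin))))

  insert-isMSP : IsMSP (suc m) c
  insert-isMSP = insert-below , insert-idempotent , insert-closedOffMin

labels-unique : (c : Carrier m) → Unique (labels c)
labels-unique {m} c = concatMap-unique _,_ ,-injective (λ _ → bools) (nothing ∷ map just (openBlocks c))
  (nothing∉ ∷ UniqueP.map⁺ MaybeP.just-injective (UniqueP.filter⁺ (λ i → isOpenBlock c i ≟B true) (UniqueP.allFin⁺ m)))
  (λ _ → bools-unique)
  where
  nothing∉ : {is : List (Fin m)} → All (λ t → ¬ nothing ≡ t) (map just is)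
  nothing∉ {[]}     = []
  nothing∉ {_ ∷ is} = (λ ()) ∷ nothing∉

insertionData : (m : ℕ) → List (Carrier m × Label m)
insertionData m = concatMap (λ c′ → map (c′ ,_) (labels c′)) (markedSetPartitions m)

insertionData-unique : (m : ℕ) → Unique (insertionData m)
insertionData-unique m = concatMap-unique _,_ ,-injective labels (markedSetPartitions m)
  (markedSetPartitions-unique m) labels-unique

insert-into : {p : Carrier m × Label m} → p ∈ insertionData m →
  uncurry insert p ∈ markedSetPartitions (suc m) × (restrict (uncurry insert p) , labelOf (uncurry insert p)) ≡ p
insert-into {m} {(rep′ , mk′) , (t , b)} p∈
  with find (∈P.∈-concatMap⁻ (λ c′ → map (c′ ,_) (labels c′)) {xs = markedSetPartitions m} p∈)
... | c′ , c′∈ , p∈c′ with ∈P.∈-map⁻ (c′ ,_) p∈c′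
... | l , l∈ , refl =
  markedSetPartitions-complete (suc m) insert-isMSP , cong₂ _,_ restrict-insert labelOf-insert
  where open Insertion rep′ mk′ (markedSetPartitions-sound m c′∈) (labels-target c′ l∈) b

restrict-into : {c : Carrier (suc m)} → c ∈ markedSetPartitions (suc m) →
  (restrict c , labelOf c) ∈ insertionData m × insert (restrict c) (labelOf c) ≡ c
restrict-into {m} {rep , mk} c∈ =
  ∈-concatMap (λ c′ → map (c′ ,_) (labels c′)) (markedSetPartitions m)
    (markedSetPartitions-complete m restrict-isMSP) (∈P.∈-map⁺ (restrict (rep , mk) ,_) labelOf∈labels) ,
  insert-restrict
  where open Restriction rep mk (markedSetPartitions-sound (suc m) c∈)

sum-by-last-element : (m : ℕ) (F : Carrier (suc m) → ℤ) →
  sumOf F (markedSetPartitions (suc m)) ≡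
  sumOf (λ c′ → sumOf (λ l → F (insert c′ l)) (labels c′)) (markedSetPartitions m)
sum-by-last-element m F = begin
  sumOf F (markedSetPartitions (suc m))
    ≡⟨ sumOf-bijection (uncurry insert) (λ c → restrict c , labelOf c)
         (markedSetPartitions-unique (suc m)) (insertionData-unique m) insert-into restrict-into F ⟩
  sumOf (F ∘ uncurry insert) (insertionData m)
    ≡⟨ sumOf-concatMap (F ∘ uncurry insert) (λ c′ → map (c′ ,_) (labels c′)) (markedSetPartitions m) ⟩
  sumOf (λ c′ → sumOf (F ∘ uncurry insert) (map (c′ ,_) (labels c′))) (markedSetPartitions m)
    ≡⟨ sumOf-cong (markedSetPartitions m) (λ {c′} _ → sumOf-map (F ∘ uncurry insert) (c′ ,_) (labels c′)) ⟩
  sumOf (λ c′ → sumOf (λ l → F (insert c′ l)) (labels c′)) (markedSetPartitions m) ∎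
  where open ≡-Reasoning

ind : Bool → ℤ
ind b = if b then + 1 else + 0

count-as-sum : (p : X → Bool) (xs : List X) → + List.length (filter (λ x → p x ≟B true) xs) ≡ sumOf (ind ∘ p) xs
count-as-sum p []       = refl
count-as-sum p (x ∷ xs) with p x
... | true  = trans (ℤP.pos-+ 1 _) (cong (_+_ (+ 1)) (count-as-sum p xs))
... | false = trans (count-as-sum p xs) (sym (ℤP.+-identityˡ _))

sumFin : (Fin n → ℤ) → ℤ
sumFin {n} f = sumOf f (allFin n)

allFin-snoc : (m : ℕ) → allFin (suc m) ≡ map inject₁ (allFin m) ++ fromℕ m ∷ []
allFin-snoc m = trans (tabulate-snoc m id) (cong (_++ fromℕ m ∷ []) (sym (ListP.map-tabulate id inject₁)))
  where
  tabulate-snoc : (m : ℕ) (f : Fin (suc m) → X) → List.tabulate f ≡ List.tabulate (f ∘ inject₁) ++ f (fromℕ m) ∷ []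
  tabulate-snoc zero    f = refl
  tabulate-snoc (suc m) f = cong (f Fin.zero ∷_) (tabulate-snoc m (f ∘ Fin.suc))

sumFin-split : (f : Fin (suc m) → ℤ) → sumFin f ≡ sumFin (f ∘ inject₁) + f (fromℕ m)
sumFin-split {m} f = begin
  sumOf f (allFin (suc m))                                ≡⟨ cong (sumOf f) (allFin-snoc m) ⟩
  sumOf f (map inject₁ (allFin m) ++ fromℕ m ∷ [])        ≡⟨ sumOf-++ f (map inject₁ (allFin m)) _ ⟩
  sumOf f (map inject₁ (allFin m)) + (f (fromℕ m) + + 0)
    ≡⟨ cong₂ _+_ (sumOf-map f inject₁ (allFin m)) (ℤP.+-identityʳ _) ⟩
  sumFin (f ∘ inject₁) + f (fromℕ m)                      ∎
  where open ≡-Reasoning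

sumFin-cons : (f : Fin (suc n) → ℤ) → sumFin f ≡ f Fin.zero + sumFin (f ∘ Fin.suc)
sumFin-cons f = cong (λ xs → f Fin.zero + Σℤ xs)
  (trans (ListP.map-tabulate Fin.suc f) (sym (ListP.map-tabulate id (f ∘ Fin.suc))))

sumFin-update : (f g : Fin n → ℤ) (i₀ : Fin n) → (∀ i → i ≢ i₀ → f i ≡ g i) →
  sumFin f ≡ sumFin g + (f i₀ - g i₀)
sumFin-update {suc n} f g Fin.zero f≗g = begin
  sumFin f                                            ≡⟨ sumFin-cons f ⟩
  f Fin.zero + sumFin (f ∘ Fin.suc)                   ≡⟨ cong (_+_ (f Fin.zero)) tails≡ ⟩
  f Fin.zero + sumFin (g ∘ Fin.suc)                   ≡⟨ shift (f Fin.zero) (g Fin.zero) _ ⟩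
  g Fin.zero + sumFin (g ∘ Fin.suc) + (f Fin.zero - g Fin.zero) ≡⟨ cong (_+ (f Fin.zero - g Fin.zero)) (sym (sumFin-cons g)) ⟩
  sumFin g + (f Fin.zero - g Fin.zero)                ∎
  where
  open ≡-Reasoning
  tails≡ : sumFin (f ∘ Fin.suc) ≡ sumFin (g ∘ Fin.suc)
  tails≡ = sumOf-cong (allFin n) (λ {i} _ → f≗g (Fin.suc i) λ ())
  shift : ∀ a b s → a + s ≡ b + s + (a - b)
  shift = solve-∀
sumFin-update {suc n} f g (Fin.suc i₀) f≗g = begin
  sumFin f                                                  ≡⟨ sumFin-cons f ⟩
  f Fin.zero + sumFin (f ∘ Fin.suc)                         ≡⟨ cong₂ _+_ (f≗g Fin.zero λ ()) tails≡ ⟩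
  g Fin.zero + (sumFin (g ∘ Fin.suc) + (f (Fin.suc i₀) - g (Fin.suc i₀))) ≡⟨ sym (ℤP.+-assoc (g Fin.zero) _ _) ⟩
  g Fin.zero + sumFin (g ∘ Fin.suc) + (f (Fin.suc i₀) - g (Fin.suc i₀))
    ≡⟨ cong (_+ (f (Fin.suc i₀) - g (Fin.suc i₀))) (sym (sumFin-cons g)) ⟩
  sumFin g + (f (Fin.suc i₀) - g (Fin.suc i₀))              ∎
  where
  open ≡-Reasoning
  tails≡ : sumFin (f ∘ Fin.suc) ≡ sumFin (g ∘ Fin.suc) + (f (Fin.suc i₀) - g (Fin.suc i₀))
  tails≡ = sumFin-update (f ∘ Fin.suc) (g ∘ Fin.suc) i₀ (λ i i≢i₀ → f≗g (Fin.suc i) (i≢i₀ ∘ suc-injective))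

sumFin-snoc : (f : Fin (suc m) → ℤ) (g : Fin m → ℤ) → (∀ i → f (inject₁ i) ≡ g i) →
  sumFin f ≡ sumFin g + f (fromℕ m)
sumFin-snoc f g f≗g = trans (sumFin-split f) (cong (_+ f (fromℕ _)) (sumOf-cong (allFin _) (λ {i} _ → f≗g i)))

sumFin-snoc-update : (f : Fin (suc m) → ℤ) (g : Fin m → ℤ) (i₀ : Fin m) → (∀ i → i ≢ i₀ → f (inject₁ i) ≡ g i) →
  sumFin f ≡ sumFin g + (f (inject₁ i₀) - g i₀ + f (fromℕ m))
sumFin-snoc-update f g i₀ f≗g = trans (sumFin-split f)
  (trans (cong (_+ f (fromℕ _)) (sumFin-update (f ∘ inject₁) g i₀ f≗g)) (ℤP.+-assoc (sumFin g) _ _))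

-- The per-block contributions to o, ℓ, Σ min and Σ_{closed} max; d̃ is a
-- linear combination of their sums.
openTerm blockTerm minTerm closedMaxTerm : Carrier n → Fin n → ℤ
openTerm c i      = ind (isOpenBlock c i)
blockTerm c i     = ind (isBlock c i)
minTerm c i       = if isBlock c i then + blockMin i else + 0
closedMaxTerm c i = if isClosedBlock c i then + blockMax c i else + 0

o-as-sum : (c : Carrier n) → + o c ≡ sumFin (openTerm c)
o-as-sum {n} c = count-as-sum (isOpenBlock c) (allFin n)

dtilde-as-sums : (c : Carrier n) →
  dtilde c ≡ sumFin (closedMaxTerm c) - sumFin (minTerm c) + sumFin (blockTerm c) + + n * (sumFin (openTerm c) - + 1)
dtilde-as-sums {n} c = cong₂ (λ ℓ o → sumFin (closedMaxTerm c) - sumFin (minTerm c) + ℓ + + n * (o - + 1))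
  (count-as-sum (isBlock c) (allFin n)) (o-as-sum c)

-- How d̃ changes when an element is added, given the changes δ of the four
-- sums: the factor n = m+1 multiplies the change of the open count.
dtilde-change : (c′ : Carrier m) (c : Carrier (suc m)) (δmax δmin δblock δopen : ℤ) →
  sumFin (closedMaxTerm c) ≡ sumFin (closedMaxTerm c′) + δmax →
  sumFin (minTerm c)       ≡ sumFin (minTerm c′) + δmin →
  sumFin (blockTerm c)     ≡ sumFin (blockTerm c′) + δblock →
  sumFin (openTerm c)      ≡ sumFin (openTerm c′) + δopen →
  dtilde c ≡ dtilde c′ + (δmax - δmin + δblock + + suc m * δopen) + (+ o c′ - + 1)
dtilde-change {m} c′ c δmax δmin δblock δopen max≡ min≡ block≡ open≡ = begin
  dtilde c
    ≡⟨ dtilde-as-sums c ⟩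
  sumFin (closedMaxTerm c) - sumFin (minTerm c) + sumFin (blockTerm c) + + suc m * (sumFin (openTerm c) - + 1)
    ≡⟨ cong₂ (λ x y → x - y + sumFin (blockTerm c) + + suc m * (sumFin (openTerm c) - + 1)) max≡ min≡ ⟩
  Max + δmax - (Min + δmin) + sumFin (blockTerm c) + + suc m * (sumFin (openTerm c) - + 1)
    ≡⟨ cong₂ (λ x y → Max + δmax - (Min + δmin) + x + + suc m * (y - + 1)) block≡ open≡ ⟩
  Max + δmax - (Min + δmin) + (Block + δblock) + + suc m * (Open + δopen - + 1)
    ≡⟨ regroup Max Min Block Open δmax δmin δblock δopen (+ m) ⟩
  Max - Min + Block + + m * (Open - + 1) + (δmax - δmin + δblock + + suc m * δopen) + (Open - + 1)
    ≡⟨ cong₂ (λ d o → d + (δmax - δmin + δblock + + suc m * δopen) + (o - + 1))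
             (sym (dtilde-as-sums c′)) (sym (o-as-sum c′)) ⟩
  dtilde c′ + (δmax - δmin + δblock + + suc m * δopen) + (+ o c′ - + 1) ∎
  where
  open ≡-Reasoning
  Max Min Block Open : ℤ
  Max   = sumFin (closedMaxTerm c′)
  Min   = sumFin (minTerm c′)
  Block = sumFin (blockTerm c′)
  Open  = sumFin (openTerm c′)
  regroup : ∀ Max Min Block Open δmax δmin δblock δopen M →
    Max + δmax - (Min + δmin) + (Block + δblock) + (+ 1 + M) * (Open + δopen - + 1) ≡
    Max - Min + Block + M * (Open - + 1) + (δmax - δmin + δblock + (+ 1 + M) * δopen) + (Open - + 1)
  regroup = solve-∀

⌊⌋-true : {P : Set} (p? : Dec P) → P → ⌊ p? ⌋ ≡ true
⌊⌋-true p? p = trans (isYes≗does p?) (dec-true p? p)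

⌊⌋-false : {P : Set} (p? : Dec P) → ¬ P → ⌊ p? ⌋ ≡ false
⌊⌋-false p? ¬p = trans (isYes≗does p?) (dec-false p? ¬p)

does-inject₁ : (i j : Fin m) → ⌊ inject₁ i ≟F inject₁ j ⌋ ≡ ⌊ i ≟F j ⌋
does-inject₁ i j with i ≟F j | inject₁ i ≟F inject₁ j
... | yes _    | yes _    = refl
... | no _     | no _     = refl
... | yes refl | no i≢i   = ⊥-elim (i≢i refl)
... | no i≢j   | yes i≡j  = ⊥-elim (i≢j (inject₁-injective i≡j))

blockMaxStep : Vec (Fin n) n → Fin n → Fin n → ℕ → ℕ
blockMaxStep rep i j acc = if ⌊ lookup rep j ≟F i ⌋ then suc (toℕ j) ⊔ acc else acc

blockMax-snoc : (rep : Vec (Fin (suc m)) (suc m)) (mk : Vec Bool (suc m)) (i : Fin (suc m)) →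
  blockMax (rep , mk) i ≡ foldr (blockMaxStep rep i ∘ inject₁) (blockMaxStep rep i (fromℕ m) 0) (allFin m)
blockMax-snoc {m} rep mk i = begin
  foldr (blockMaxStep rep i) 0 (allFin (suc m))
    ≡⟨ cong (foldr (blockMaxStep rep i) 0) (allFin-snoc m) ⟩
  foldr (blockMaxStep rep i) 0 (map inject₁ (allFin m) ++ fromℕ m ∷ [])
    ≡⟨ ListP.foldr-++ (blockMaxStep rep i) 0 (map inject₁ (allFin m)) _ ⟩
  foldr (blockMaxStep rep i) (blockMaxStep rep i (fromℕ m) 0) (map inject₁ (allFin m))
    ≡⟨ ListP.foldr-map (blockMaxStep rep i) inject₁ _ (allFin m) ⟩
  foldr (blockMaxStep rep i ∘ inject₁) (blockMaxStep rep i (fromℕ m) 0) (allFin m) ∎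
  where open ≡-Reasoning

foldr-max-bounded : (p : X → Bool) (a : X → ℕ) (s : ℕ) (xs : List X) → (∀ x → a x ℕ.≤ s) →
  foldr (λ x acc → if p x then a x ⊔ acc else acc) s xs ≡ s
foldr-max-bounded p a s []       a≤s = refl
foldr-max-bounded p a s (x ∷ xs) a≤s with p x
... | true  = trans (cong (a x ⊔_) (foldr-max-bounded p a s xs a≤s)) (ℕP.m≤n⇒m⊔n≡n (a≤s x))
... | false = foldr-max-bounded p a s xs a≤s

-- Block data of insert c′ (t , b) at old elements: the same as in c′, except
-- that the block receiving m+1 now has maximum m+1 and mark b.
module InsertedBlocks {m : ℕ} (rep′ : Vec (Fin m) m) (mk′ : Vec Bool m) (t : Maybe (Fin m)) (b : Bool) where

  c′ : Carrier m
  c′ = rep′ , mk′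

  c : Carrier (suc m)
  c = insert c′ (t , b)

  isBlock-old : ∀ i → isBlock c (inject₁ i) ≡ isBlock c′ i
  isBlock-old i = trans (cong (λ j → ⌊ j ≟F inject₁ i ⌋) (insert-rep-old rep′ mk′ t b i)) (does-inject₁ _ _)

  isBlock-last : isBlock c (fromℕ m) ≡ ⌊ targetRep t ≟F fromℕ m ⌋
  isBlock-last = cong (λ j → ⌊ j ≟F fromℕ m ⌋) (insert-rep-last rep′ mk′ t b)

  blockMax-old : ∀ i → t ≢ just i → blockMax c (inject₁ i) ≡ blockMax c′ i
  blockMax-old i t≢i = trans (blockMax-snoc (proj₁ c) (proj₂ c) (inject₁ i))
    (trans (cong (λ s → foldr (blockMaxStep (proj₁ c) (inject₁ i) ∘ inject₁) s (allFin m)) lastNotInBlock)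
           (ListP.foldr-cong oldSteps refl (allFin m)))
    where
    lastNotInBlock : blockMaxStep (proj₁ c) (inject₁ i) (fromℕ m) 0 ≡ 0
    lastNotInBlock with lookup (proj₁ c) (fromℕ m) ≟F inject₁ i
    ... | no _      = refl
    ... | yes last↦i = ⊥-elim (t≢i (begin
      t                              ≡⟨ sym (unlast-targetRep t) ⟩
      unlast (targetRep t)           ≡⟨ cong unlast (trans (sym (insert-rep-last rep′ mk′ t b)) last↦i) ⟩
      unlast (inject₁ i)             ≡⟨ unlast-inject₁ i ⟩
      just i                         ∎))
      where open ≡-Reasoning
    oldSteps : ∀ j acc → blockMaxStep (proj₁ c) (inject₁ i) (inject₁ j) acc ≡ blockMaxStep rep′ i j acc
    oldSteps j acc rewrite insert-rep-old rep′ mk′ t b j | does-inject₁ (lookup rep′ j) i | toℕ-inject₁ j = refl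

  blockMax-target : blockMax c (targetRep t) ≡ suc m
  blockMax-target = trans (blockMax-snoc (proj₁ c) (proj₂ c) (targetRep t))
    (trans (cong (λ s → foldr (blockMaxStep (proj₁ c) (targetRep t) ∘ inject₁) s (allFin m)) lastInBlock)
           (foldr-max-bounded _ (λ j → suc (toℕ (inject₁ j))) (suc m) (allFin m) oldBelow))
    where
    lastInBlock : blockMaxStep (proj₁ c) (targetRep t) (fromℕ m) 0 ≡ suc m
    lastInBlock with lookup (proj₁ c) (fromℕ m) ≟F targetRep t
    ... | yes _          = trans (ℕP.⊔-identityʳ _) (cong suc (toℕ-fromℕ m))
    ... | no last↦other = ⊥-elim (last↦other (insert-rep-last rep′ mk′ t b))
    oldBelow : ∀ j → suc (toℕ (inject₁ j)) ℕ.≤ suc m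
    oldBelow j = ℕP.<⇒≤ (ℕ.s≤s (subst (ℕ._< m) (sym (toℕ-inject₁ j)) (toℕ<n j)))

  isClosedBlock-old : ∀ i → isClosedBlock c (inject₁ i) ≡
    (if isBlock c′ i then (if markAfter mk′ t b i then false else true) else false)
  isClosedBlock-old i = cong₂ (λ x y → if x then (if y then false else true) else false)
    (isBlock-old i) (insert-mark-old rep′ mk′ t b i)

  isOpenBlock-old : ∀ i → isOpenBlock c (inject₁ i) ≡ (if isBlock c′ i then markAfter mk′ t b i else false)
  isOpenBlock-old i = cong₂ (λ x y → if x then y else false) (isBlock-old i) (insert-mark-old rep′ mk′ t b i)

  blockTerm-old : ∀ i → blockTerm c (inject₁ i) ≡ blockTerm c′ i
  blockTerm-old i = cong ind (isBlock-old i)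

  minTerm-old : ∀ i → minTerm c (inject₁ i) ≡ minTerm c′ i
  minTerm-old i = cong₂ (λ x y → if x then + y else + 0) (isBlock-old i) (cong suc (toℕ-inject₁ i))

  openTerm-old : ∀ i → t ≢ just i → openTerm c (inject₁ i) ≡ openTerm c′ i
  openTerm-old i t≢i = cong ind (trans (isOpenBlock-old i)
    (cong (λ y → if isBlock c′ i then y else false) (markAfter-untouched mk′ t b i t≢i)))

  closedMaxTerm-old : ∀ i → t ≢ just i → closedMaxTerm c (inject₁ i) ≡ closedMaxTerm c′ i
  closedMaxTerm-old i t≢i = cong₂ (λ x y → if x then + y else + 0)
    (trans (isClosedBlock-old i) (cong (λ y → if isBlock c′ i then (if y then false else true) else false)
                                       (markAfter-untouched mk′ t b i t≢i)))
    (blockMax-old i t≢i)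

closedValue : (b : Bool) (x : ℤ) → (if (if b then false else true) then x else + 0) ≡ x * (+ 1 - ind b)
closedValue true  x = sym (ℤP.*-zeroʳ x)
closedValue false x = sym (ℤP.*-identityʳ x)

module NewBlock {m : ℕ} (rep′ : Vec (Fin m) m) (mk′ : Vec Bool m) (b : Bool) where

  open InsertedBlocks rep′ mk′ nothing b public

  lastIsBlock : isBlock c (fromℕ m) ≡ true
  lastIsBlock = trans isBlock-last (⌊⌋-true (fromℕ m ≟F fromℕ m) refl)

  lastMark : lookup (proj₂ c) (fromℕ m) ≡ b
  lastMark = insert-mark-last rep′ mk′ nothing b

  openSum : sumFin (openTerm c) ≡ sumFin (openTerm c′) + ind b
  openSum = trans (sumFin-snoc (openTerm c) (openTerm c′) (λ i → openTerm-old i (λ ())))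
    (cong (_+_ (sumFin (openTerm c′))) (cong₂ (λ x y → ind (if x then y else false)) lastIsBlock lastMark))

  blockSum : sumFin (blockTerm c) ≡ sumFin (blockTerm c′) + + 1
  blockSum = trans (sumFin-snoc (blockTerm c) (blockTerm c′) blockTerm-old)
    (cong (_+_ (sumFin (blockTerm c′))) (cong ind lastIsBlock))

  minSum : sumFin (minTerm c) ≡ sumFin (minTerm c′) + + suc m
  minSum = trans (sumFin-snoc (minTerm c) (minTerm c′) minTerm-old)
    (cong (_+_ (sumFin (minTerm c′))) (cong₂ (λ x y → if x then + suc y else + 0) lastIsBlock (toℕ-fromℕ m)))

  closedMaxSum : sumFin (closedMaxTerm c) ≡ sumFin (closedMaxTerm c′) + + suc m * (+ 1 - ind b)
  closedMaxSum = trans (sumFin-snoc (closedMaxTerm c) (closedMaxTerm c′) (λ i → closedMaxTerm-old i (λ ())))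
    (cong (_+_ (sumFin (closedMaxTerm c′))) (begin
      closedMaxTerm c (fromℕ m)
        ≡⟨ cong₂ (λ x y → if (if x then (if y then false else true) else false) then + blockMax c (fromℕ m) else + 0)
                 lastIsBlock lastMark ⟩
      (if (if b then false else true) then + blockMax c (fromℕ m) else + 0)
        ≡⟨ cong (λ y → if (if b then false else true) then + y else + 0) blockMax-target ⟩
      (if (if b then false else true) then + suc m else + 0)
        ≡⟨ closedValue b (+ suc m) ⟩
      + suc m * (+ 1 - ind b) ∎))
    where open ≡-Reasoning

newBlock-statistics : (c′ : Carrier m) (b : Bool) →
  dtilde (insert c′ (nothing , b)) ≡ dtilde c′ + + o c′ × + o (insert c′ (nothing , b)) ≡ + o c′ + ind b
newBlock-statistics {m} (rep′ , mk′) b =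
  trans (dtilde-change c′ c _ _ _ _ closedMaxSum minSum blockSum openSum) (simplify (dtilde c′) (+ o c′) (ind b) (+ m)) ,
  trans (o-as-sum c) (trans openSum (cong (_+ ind b) (sym (o-as-sum c′))))
  where
  open NewBlock rep′ mk′ b
  simplify : ∀ D O β M → D + ((+ 1 + M) * (+ 1 - β) - (+ 1 + M) + + 1 + (+ 1 + M) * β) + (O - + 1) ≡ D + O
  simplify = solve-∀

-- m+1 joining the open block i₀: only the summands at i₀ change (the block is
-- open in λ′ and has mark b and maximum m+1 afterwards); m+1 is no block minimum.
module JoinBlock {m : ℕ} (rep′ : Vec (Fin m) m) (mk′ : Vec Bool m) (b : Bool) {i₀ : Fin m}
                 (i₀-open : isOpenBlock (rep′ , mk′) i₀ ≡ true) where

  open InsertedBlocks rep′ mk′ (just i₀) b public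

  i₀-min-and-open : lookup rep′ i₀ ≡ i₀ × lookup mk′ i₀ ≡ true
  i₀-min-and-open = isOpenBlock-elim rep′ mk′ i₀ i₀-open

  i₀-isBlock : isBlock c′ i₀ ≡ true
  i₀-isBlock = ⌊⌋-true (lookup rep′ i₀ ≟F i₀) (proj₁ i₀-min-and-open)

  i₀-mark : markAfter mk′ (just i₀) b i₀ ≡ b
  i₀-mark = markAfter-target mk′ i₀ b

  untouched : ∀ i → i ≢ i₀ → just i₀ ≢ just i
  untouched i i≢i₀ refl = i≢i₀ refl

  lastIsNotBlock : isBlock c (fromℕ m) ≡ false
  lastIsNotBlock = trans isBlock-last (⌊⌋-false (inject₁ i₀ ≟F fromℕ m) (fromℕ≢inject₁ ∘ sym))

  openSum : sumFin (openTerm c) ≡ sumFin (openTerm c′) + (ind b - + 1 + + 0)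
  openSum = trans (sumFin-snoc-update (openTerm c) (openTerm c′) i₀ (λ i i≢i₀ → openTerm-old i (untouched i i≢i₀)))
    (cong₂ (λ x y → sumFin (openTerm c′) + (x + y))
      (cong₂ _-_ (cong ind (trans (isOpenBlock-old i₀) (cong₂ (λ x y → if x then y else false) i₀-isBlock i₀-mark)))
                 (cong ind i₀-open))
      (cong (λ x → ind (if x then lookup (proj₂ c) (fromℕ m) else false)) lastIsNotBlock))

  blockSum : sumFin (blockTerm c) ≡ sumFin (blockTerm c′) + + 0
  blockSum = trans (sumFin-snoc (blockTerm c) (blockTerm c′) blockTerm-old)
    (cong (_+_ (sumFin (blockTerm c′))) (cong ind lastIsNotBlock))

  minSum : sumFin (minTerm c) ≡ sumFin (minTerm c′) + + 0
  minSum = trans (sumFin-snoc (minTerm c) (minTerm c′) minTerm-old)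
    (cong (_+_ (sumFin (minTerm c′))) (cong (λ x → if x then + blockMin (fromℕ m) else + 0) lastIsNotBlock))

  closedMaxSum : sumFin (closedMaxTerm c) ≡ sumFin (closedMaxTerm c′) + (+ suc m * (+ 1 - ind b) - + 0 + + 0)
  closedMaxSum = trans (sumFin-snoc-update (closedMaxTerm c) (closedMaxTerm c′) i₀
                          (λ i i≢i₀ → closedMaxTerm-old i (untouched i i≢i₀)))
    (cong₂ (λ x y → sumFin (closedMaxTerm c′) + (x + y)) (cong₂ _-_ i₀-closedMax i₀-wasOpen) lastTerm)
    where
    open ≡-Reasoning
    i₀-closedMax : closedMaxTerm c (inject₁ i₀) ≡ + suc m * (+ 1 - ind b)
    i₀-closedMax = begin
      closedMaxTerm c (inject₁ i₀)
        ≡⟨ cong₂ (λ x y → if x then + y else + 0)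
                 (trans (isClosedBlock-old i₀)
                        (cong₂ (λ x y → if x then (if y then false else true) else false) i₀-isBlock i₀-mark))
                 blockMax-target ⟩
      (if (if b then false else true) then + suc m else + 0)
        ≡⟨ closedValue b (+ suc m) ⟩
      + suc m * (+ 1 - ind b) ∎
    i₀-wasOpen : closedMaxTerm c′ i₀ ≡ + 0
    i₀-wasOpen = cong (λ x → if x then + blockMax c′ i₀ else + 0)
      (cong₂ (λ x y → if x then (if y then false else true) else false) i₀-isBlock (proj₂ i₀-min-and-open))
    lastTerm : closedMaxTerm c (fromℕ m) ≡ + 0
    lastTerm = cong (λ x → if (if x then (if lookup (proj₂ c) (fromℕ m) then false else true) else false)
                            then + blockMax c (fromℕ m) else + 0) lastIsNotBlock

joinBlock-statistics : (c′ : Carrier m) (b : Bool) {i₀ : Fin m} → isOpenBlock c′ i₀ ≡ true →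
  dtilde (insert c′ (just i₀ , b)) ≡ dtilde c′ + (+ o c′ - + 1) ×
  + o (insert c′ (just i₀ , b)) ≡ + o c′ + (ind b - + 1)
joinBlock-statistics {m} (rep′ , mk′) b i₀-open =
  trans (dtilde-change c′ c _ _ _ _ closedMaxSum minSum blockSum openSum) (simplify (dtilde c′) (+ o c′) (ind b) (+ m)) ,
  trans (o-as-sum c) (trans openSum (cong₂ _+_ (sym (o-as-sum c′)) (ℤP.+-identityʳ (ind b - + 1))))
  where
  open JoinBlock rep′ mk′ b i₀-open
  simplify : ∀ D O β M →
    D + ((+ 1 + M) * (+ 1 - β) - + 0 + + 0 - + 0 + + 0 + (+ 1 + M) * (β - + 1 + + 0)) + (O - + 1) ≡ D + (O - + 1)
  simplify = solve-∀

power≡Exp : (x : ℤ) (n : ℕ) → x Exp.^ n ≡ x ^ n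
power≡Exp x zero    = refl
power≡Exp x (suc n) = cong (x *_) (power≡Exp x n)

multiple≡* : (n : ℕ) (z : ℤ) → RawMonoid._×_ (Semiring.+-rawMonoid ℤP.+-*-semiring) n z ≡ + n * z
multiple≡* zero    z = sym (ℤP.*-zeroˡ z)
multiple≡* (suc n) z = begin
  z + RawMonoid._×_ (Semiring.+-rawMonoid ℤP.+-*-semiring) n z ≡⟨ cong (_+_ z) (multiple≡* n z) ⟩
  z + + n * z                                                  ≡⟨ cong (_+ + n * z) (sym (ℤP.*-identityˡ z)) ⟩
  + 1 * z + + n * z                                            ≡⟨ sym (ℤP.*-distribʳ-+ z (+ 1) (+ n)) ⟩
  + suc n * z                                                  ∎
  where open ≡-Reasoning

vectorSum≡Σℤ : (n : ℕ) (g : ℕ → ℤ) → Vector.foldr _+_ (+ 0) {n} (g ∘ toℕ) ≡ Σℤ (applyUpTo g n)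
vectorSum≡Σℤ zero    g = refl
vectorSum≡Σℤ (suc n) g = cong (_+_ (g 0)) (vectorSum≡Σℤ n (g ∘ suc))

binomial-theorem : (d x : ℤ) (k : ℕ) → (d + x) ^ k ≡ sumOf (λ j → + (k C j) * x ^ (k ∸ j) * d ^ j) (upTo (suc k))
binomial-theorem d x k = begin
  (d + x) ^ k                                      ≡⟨ sym (power≡Exp (d + x) k) ⟩
  (d + x) Exp.^ k                                  ≡⟨ Binomial.theorem k d x ⟩
  Binomial.binomialExpansion d x k                 ≡⟨ vectorSum≡Σℤ (suc k) term ⟩
  Σℤ (applyUpTo term (suc k))                      ≡⟨ cong Σℤ (sym (ListP.map-applyUpTo id term (suc k))) ⟩
  sumOf term (upTo (suc k))                        ≡⟨ sumOf-cong (upTo (suc k)) (λ {j} _ → term≡ j) ⟩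
  sumOf (λ j → + (k C j) * x ^ (k ∸ j) * d ^ j) (upTo (suc k)) ∎
  where
  open ≡-Reasoning
  term : ℕ → ℤ
  term j = RawMonoid._×_ (Semiring.+-rawMonoid ℤP.+-*-semiring) (k C j) (d Exp.^ j * x Exp.^ (k ∸ j))
  term≡ : ∀ j → term j ≡ + (k C j) * x ^ (k ∸ j) * d ^ j
  term≡ j = begin
    term j                                ≡⟨ multiple≡* (k C j) _ ⟩
    + (k C j) * (d Exp.^ j * x Exp.^ (k ∸ j))
      ≡⟨ cong₂ (λ u v → + (k C j) * (u * v)) (power≡Exp d j) (power≡Exp x (k ∸ j)) ⟩
    + (k C j) * (d ^ j * x ^ (k ∸ j))     ≡⟨ cong (_*_ (+ (k C j))) (ℤP.*-comm (d ^ j) _) ⟩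
    + (k C j) * (x ^ (k ∸ j) * d ^ j)     ≡⟨ sym (ℤP.*-assoc (+ (k C j)) _ _) ⟩
    + (k C j) * x ^ (k ∸ j) * d ^ j       ∎

guard : ℤ → ℤ → ℤ → ℤ
guard X A y = if does (X ≟ℤ A) then y else + 0

guard-shift : (X s A y : ℤ) → guard (X + s) A y ≡ guard X (A - s) y
guard-shift X s A y with X + s ≟ℤ A | X ≟ℤ A - s
... | yes _   | yes _   = refl
... | no _    | no _    = refl
... | yes X+s≡A | no X≢A-s = ⊥-elim (X≢A-s (trans (sym (cancel X s)) (cong (_- s) X+s≡A)))
  where
  cancel : ∀ X s → X + s - s ≡ X
  cancel = solve-∀
... | no X+s≢A | yes X≡A-s = ⊥-elim (X+s≢A (trans (cong (_+ s) X≡A-s) (cancel A s)))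
  where
  cancel : ∀ A s → A - s + s ≡ A
  cancel = solve-∀

guard-subst : (X A : ℤ) (f : ℤ → ℤ) → guard X A (f X) ≡ guard X A (f A)
guard-subst X A f with X ≟ℤ A
... | yes refl = refl
... | no _     = refl

guard-scale : (X A y : ℤ) → X * guard X A y ≡ A * guard X A y
guard-scale X A y with X ≟ℤ A
... | yes refl = refl
... | no _     = trans (ℤP.*-zeroʳ X) (sym (ℤP.*-zeroʳ A))

power : ℕ → ℤ → Carrier m → ℤ
power k A c = guard (+ o c) A (dtilde c ^ k)

shiftedPower : ℕ → ℤ → ℤ → Carrier m → ℤ
shiftedPower k x B c = guard (+ o c) B ((dtilde c + x) ^ k)

M-as-sum : (k n : ℕ) (A : ℤ) → M k n A ≡ sumOf (power k A) (markedSetPartitions n)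
M-as-sum k n A = sumOf-filter (λ c → + o c ≟ℤ A) (λ c → dtilde c ^ k) (markedSetPartitions n)

binomSum-as-sum : (k : ℕ) (x : ℤ) (m : ℕ) (B : ℤ) →
  binomSum k x m B ≡ sumOf (shiftedPower k x B) (markedSetPartitions m)
binomSum-as-sum k x m B = begin
  sumOf (λ j → coeff j * M j m B) (upTo (suc k))
    ≡⟨ sumOf-cong (upTo (suc k)) (λ {j} _ → trans (cong (_*_ (coeff j)) (M-as-sum j m B))
                                                   (sym (sumOf-*ˡ (coeff j) (power j B) L))) ⟩
  sumOf (λ j → sumOf (λ c → coeff j * power j B c) L) (upTo (suc k))
    ≡⟨ sumOf-swap (λ j c → coeff j * power j B c) (upTo (suc k)) L ⟩
  sumOf (λ c → sumOf (λ j → coeff j * power j B c) (upTo (suc k))) L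
    ≡⟨ sumOf-cong L (λ {c} _ → expand c) ⟩
  sumOf (shiftedPower k x B) L ∎
  where
  open ≡-Reasoning
  L : List (Carrier m)
  L = markedSetPartitions m
  coeff : ℕ → ℤ
  coeff j = + (k C j) * x ^ (k ∸ j)
  expand : (c : Carrier m) → sumOf (λ j → coeff j * power j B c) (upTo (suc k)) ≡ shiftedPower k x B c
  expand c with + o c ≟ℤ B
  ... | yes _ = sym (binomial-theorem (dtilde c) x k)
  ... | no _  = trans (sumOf-cong (upTo (suc k)) (λ {j} _ → ℤP.*-zeroʳ (coeff j)))
                      (sumOf-zero (upTo (suc k)))

-- The contributions of the labels of a single λ′ to Σ [o = A] d̃^k, expressed
-- by the shifted powers r₁, r₂ (new block, open / closed) and q₃, q₄ (joining
-- an open block, which stays open / is closed) of λ′.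
module LabelSums {m : ℕ} (k : ℕ) (A : ℤ) (c′ : Carrier m) where

  F : Label m → ℤ
  F = power k A ∘ insert c′

  O D r₁ r₂ q₃ q₄ : ℤ
  O  = + o c′
  D  = dtilde c′
  r₁ = shiftedPower k (A - + 1) (A - + 1) c′
  r₂ = shiftedPower k A A c′
  q₃ = shiftedPower k (A - + 1) A c′
  q₄ = shiftedPower k A (A + + 1) c′

  newBlock-term : ∀ b → F (nothing , b) ≡ guard (O + ind b) A ((D + O) ^ k)
  newBlock-term b = cong₂ (λ o d → guard o A (d ^ k))
    (proj₂ (newBlock-statistics c′ b)) (proj₁ (newBlock-statistics c′ b))

  newBlock-terms : sumOf F (map (nothing ,_) bools) ≡ r₁ + r₂
  newBlock-terms = cong₂ _+_
    (trans (newBlock-term true) (trans (guard-shift O (+ 1) A ((D + O) ^ k)) (guard-subst O (A - + 1) (λ z → (D + z) ^ k))))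
    (trans (ℤP.+-identityʳ _) (trans (newBlock-term false)
      (trans (cong (λ z → guard z A ((D + O) ^ k)) (ℤP.+-identityʳ O)) (guard-subst O A (λ z → (D + z) ^ k)))))

  joinBlock-term : ∀ {i₀} → isOpenBlock c′ i₀ ≡ true → ∀ b →
    F (just i₀ , b) ≡ guard (O + (ind b - + 1)) A ((D + (O - + 1)) ^ k)
  joinBlock-term i₀-open b = cong₂ (λ o d → guard o A (d ^ k))
    (proj₂ (joinBlock-statistics c′ b i₀-open)) (proj₁ (joinBlock-statistics c′ b i₀-open))

  joinBlock-terms : ∀ {i₀} → i₀ ∈ openBlocks c′ → sumOf F (map (just i₀ ,_) bools) ≡ q₃ + q₄
  joinBlock-terms {i₀} i₀∈ = cong₂ _+_
    (trans (joinBlock-term i₀-open true) (trans (cong (λ z → guard z A ((D + (O - + 1)) ^ k)) (ℤP.+-identityʳ O))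
                                                (guard-subst O A (λ z → (D + (z - + 1)) ^ k))))
    (trans (ℤP.+-identityʳ _) (trans (joinBlock-term i₀-open false) (trans (guard-shift O (- + 1) A ((D + (O - + 1)) ^ k))
      (trans (guard-subst O (A + + 1) (λ z → (D + (z - + 1)) ^ k)) (cong (λ z → guard O (A + + 1) ((D + z) ^ k)) (cancel A))))))
    where
    i₀-open : isOpenBlock c′ i₀ ≡ true
    i₀-open = proj₂ (∈P.∈-filter⁻ (λ i → isOpenBlock c′ i ≟B true) {xs = allFin m} i₀∈)
    cancel : ∀ A → A + + 1 - + 1 ≡ A
    cancel = solve-∀

-- The recurrence for a single λ′: the o(λ′) open blocks contribute o(λ′) equal
-- terms, and under their guards the factor o(λ′) becomes A or A + 1.
labels-recurrence : (k : ℕ) (A : ℤ) (c′ : Carrier m) →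
  sumOf (power k A ∘ insert c′) (labels c′) ≡
  shiftedPower k (A - + 1) (A - + 1) c′ + shiftedPower k A A c′
  + A * shiftedPower k (A - + 1) A c′ + (A + + 1) * shiftedPower k A (A + + 1) c′
labels-recurrence k A c′ = begin
  sumOf F (labels c′)
    ≡⟨ sumOf-concatMap F (λ t → map (t ,_) bools) (nothing ∷ map just (openBlocks c′)) ⟩
  sumOf (λ t → sumOf F (map (t ,_) bools)) (nothing ∷ map just (openBlocks c′))
    ≡⟨ cong₂ _+_ newBlock-terms (sumOf-map (λ t → sumOf F (map (t ,_) bools)) just (openBlocks c′)) ⟩
  r₁ + r₂ + sumOf (λ i₀ → sumOf F (map (just i₀ ,_) bools)) (openBlocks c′)
    ≡⟨ cong (_+_ (r₁ + r₂)) (sumOf-cong (openBlocks c′) joinBlock-terms) ⟩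
  r₁ + r₂ + sumOf (λ _ → q₃ + q₄) (openBlocks c′)
    ≡⟨ cong (_+_ (r₁ + r₂)) (sumOf-const (q₃ + q₄) (openBlocks c′)) ⟩
  r₁ + r₂ + O * (q₃ + q₄)
    ≡⟨ cong (_+_ (r₁ + r₂)) (trans (ℤP.*-distribˡ-+ O q₃ q₄)
                                   (cong₂ _+_ (guard-scale O A _) (guard-scale O (A + + 1) _))) ⟩
  r₁ + r₂ + (A * q₃ + (A + + 1) * q₄)
    ≡⟨ sym (ℤP.+-assoc (r₁ + r₂) _ _) ⟩
  r₁ + r₂ + A * q₃ + (A + + 1) * q₄ ∎
  where
  open ≡-Reasoning
  open LabelSums k A c′

sumOf-combination : (f g h e : X → ℤ) (a b : ℤ) (xs : List X) →
  sumOf (λ x → f x + g x + a * h x + b * e x) xs ≡ sumOf f xs + sumOf g xs + a * sumOf h xs + b * sumOf e xs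
sumOf-combination f g h e a b xs = begin
  sumOf (λ x → f x + g x + a * h x + b * e x) xs
    ≡⟨ sumOf-+ (λ x → f x + g x + a * h x) (λ x → b * e x) xs ⟩
  sumOf (λ x → f x + g x + a * h x) xs + sumOf (λ x → b * e x) xs
    ≡⟨ cong₂ _+_ (sumOf-+ (λ x → f x + g x) (λ x → a * h x) xs) (sumOf-*ˡ b e xs) ⟩
  sumOf (λ x → f x + g x) xs + sumOf (λ x → a * h x) xs + b * sumOf e xs
    ≡⟨ cong₂ (λ u v → u + v + b * sumOf e xs) (sumOf-+ f g xs) (sumOf-*ˡ a h xs) ⟩
  sumOf f xs + sumOf g xs + a * sumOf h xs + b * sumOf e xs ∎
  where open ≡-Reasoning

corollary4p2 : (n : ℕ) → 1 ≤ n → (k : ℕ) → (A : ℤ) →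
    M k n A ≡
      binomSum k (A - + 1) (n ∸ 1) (A - + 1)
      + binomSum k A (n ∸ 1) A
      + A * binomSum k (A - + 1) (n ∸ 1) A
      + (A + + 1) * binomSum k A (n ∸ 1) (A + + 1)
corollary4p2 (suc m) (s≤s z≤n) k A = begin
  M k (suc m) A
    ≡⟨ M-as-sum k (suc m) A ⟩
  sumOf (power k A) (markedSetPartitions (suc m))
    ≡⟨ sum-by-last-element m (power k A) ⟩
  sumOf (λ c′ → sumOf (power k A ∘ insert c′) (labels c′)) L
    ≡⟨ sumOf-cong L (λ {c′} _ → labels-recurrence k A c′) ⟩
  sumOf (λ c′ → r₁ c′ + r₂ c′ + A * q₃ c′ + (A + + 1) * q₄ c′) L
    ≡⟨ sumOf-combination r₁ r₂ q₃ q₄ A (A + + 1) L ⟩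
  sumOf r₁ L + sumOf r₂ L + A * sumOf q₃ L + (A + + 1) * sumOf q₄ L
    ≡⟨ sym (cong₂ (λ u v → u + v + A * sumOf q₃ L + (A + + 1) * sumOf q₄ L)
                  (binomSum-as-sum k (A - + 1) m (A - + 1)) (binomSum-as-sum k A m A)) ⟩
  binomSum k (A - + 1) m (A - + 1) + binomSum k A m A + A * sumOf q₃ L + (A + + 1) * sumOf q₄ L
    ≡⟨ sym (cong₂ (λ u v → binomSum k (A - + 1) m (A - + 1) + binomSum k A m A + A * u + (A + + 1) * v)
                  (binomSum-as-sum k (A - + 1) m A) (binomSum-as-sum k A m (A + + 1))) ⟩
  binomSum k (A - + 1) m (A - + 1) + binomSum k A m A + A * binomSum k (A - + 1) m A
    + (A + + 1) * binomSum k A m (A + + 1) ∎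
  where
  open ≡-Reasoning
  L : List (Carrier m)
  L = markedSetPartitions m
  r₁ r₂ q₃ q₄ : Carrier m → ℤ
  r₁ = shiftedPower k (A - + 1) (A - + 1)
  r₂ = shiftedPower k A A
  q₃ = shiftedPower k (A - + 1) A
  q₄ = shiftedPower k A (A + + 1)
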